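{- For every integer $n\geq 7$ with $n\equiv 1$ or $5\pmod 6$, there exists a regular SAMS$(n,4)$.
   Context: For positive integers $n,d$ with $d<n$, an $n\times n$ array $A$ with entries in $\{0,1,\dots,nd\}$ is a sparse anti-magic square of order $n$ with density $d$, denoted SAMS$(n,d)$, if each element of $\{1,2,\dots,nd\}$ occurs in exactly one entry of $A$ (all other entries being $0$), and the $n$ row-sums, $n$ column-sums and the two main diagonal sums (left diagonal: entries $(i,i)$; right diagonal: entries $(i,n+1-i)$) together form a set of $2n+2$ consecutive integers. An SAMS$(n,d)$ is regular if each row, each column and each of the two main diagonals contains exactly $d$ positive entries. -}

module Defs where

open import Data.Nat using (ℕ; zero; suc; _+_; _*_; _≤_; _<_; _%_)
open import Data.Fin using (Fin; zero; suc; opposite)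
open import Data.Product using (Σ; _×_; _,_; ∃)
open import Data.Sum using (_⊎_; inj₁; inj₂)
open import Relation.Binary.PropositionalEquality using (_≡_)

Σᶠ : ∀ {n} → (Fin n → ℕ) → ℕ
Σᶠ {zero}  f = 0
Σᶠ {suc n} f = f zero + Σᶠ (λ i → f (suc i))

positives : ∀ {n} → (Fin n → ℕ) → ℕ
positives {zero}  f = 0
positives {suc n} f with f zero
... | zero  = positives (λ i → f (suc i))
... | suc _ = suc (positives (λ i → f (suc i)))

Array : ℕ → Set
Array n = Fin n → Fin n → ℕ

data Line (n : ℕ) : Set where
  row    : Fin n → Line n
  col    : Fin n → Line n
  leftD  : Line n
  rightD : Line n

-- Entries along a line, indexed by Fin n.
-- Left diagonal: entries (i,i); right diagonal: entries (i, n+1-i) (1-based),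
-- i.e. (i, opposite i) with 0-based Fin indices.
entries : ∀ {n} → Array n → Line n → Fin n → ℕ
entries A (row i) j = A i j
entries A (col j) i = A i j
entries A leftD   i = A i i
entries A rightD  i = A i (opposite i)

lineSum : ∀ {n} → Array n → Line n → ℕ
lineSum A l = Σᶠ (entries A l)

EntriesOK : (n d : ℕ) → Array n → Set
EntriesOK n d A =
  (∀ i j → A i j ≤ n * d) ×
  (∀ k → 1 ≤ k → k ≤ n * d →
     (Σ (Fin n × Fin n) λ { (i , j) → A i j ≡ k }) ×
     (∀ i j i' j' → A i j ≡ k → A i' j' ≡ k → (i ≡ i') × (j ≡ j')))

-- The 2n+2 line sums together form a set of 2n+2 consecutive integers:
-- they are pairwise distinct and all lie in {a, a+1, ..., a+2n+1} for some a.
ConsecutiveSums : (n : ℕ) → Array n → Set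
ConsecutiveSums n A =
  Σ ℕ λ a →
    (∀ l → a ≤ lineSum A l × lineSum A l < a + (2 * n + 2)) ×
    (∀ l l' → lineSum A l ≡ lineSum A l' → l ≡ l')

SAMS : (n d : ℕ) → Array n → Set
SAMS n d A = d < n × EntriesOK n d A × ConsecutiveSums n A

Regular : (n d : ℕ) → Array n → Set
Regular n d A = ∀ l → positives (entries A l) ≡ d

-- Write a positive entry as 1 + k n + w with label k < 4 and offset w < n, the pairs (k , w)
-- running over {0,…,3} × {0,…,n−1} exactly once. If every line has four positive entries whose
-- labels add up to 6, its sum is 6n + 4 + W, where W is the sum of its offsets; so the array is a
-- regular SAMS(n,4) as soon as the 2n+2 offset sums are distinct and lie in [n−2, 3n).
--
-- Such layouts of orders 7, 11, 13 and 17 are verified by computation, and one of order n yields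
-- one of order n + 12 by adding six rows and columns on each side. A core cell of label k has its
-- offset w moved to 6 + k + w; a fixed 12 × 12 gadget fills the four corner blocks, its cell of
-- label k and residue x < 12 receiving offset x if x < 6 + k and n + x otherwise, so that every
-- label still meets each offset below n + 12 exactly once. The old lines gain 30 in their offset
-- sums, which then lie in [n+28, 3n+30), while the rows and columns of the gadget get n + c with
-- 10 ≤ c ≤ 27 or 3n + c with 30 ≤ c ≤ 35, the residue sums c being pairwise distinct.

module Submission where

open import Defs
open import Data.Bool using (Bool; true; false)
open import Data.Bool.Properties using () renaming (_≟_ to _≟ᴮ_)
open import Data.Empty using (⊥-elim)
open import Data.Fin using (Fin; zero; suc; toℕ; fromℕ<; opposite; _↑ˡ_; _↑ʳ_; splitAt)
open import Data.Fin.Properties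
  using (all?; any?; toℕ-fromℕ<; toℕ-injective; toℕ-↑ˡ; toℕ-↑ʳ; toℕ<n; opposite-prop; opposite-involutive;
         splitAt-↑ˡ; splitAt-↑ʳ; join-splitAt)
  renaming (_≟_ to _≟ᶠ_)
open import Data.Maybe as Maybe using (Maybe; just; nothing; maybe′)
open import Data.Maybe.Properties using (just-injective; map-just; map-nothing; maybe′-map) renaming (≡-dec to ≡-dec-Maybe)
open import Data.Maybe.Relation.Unary.All as All using (All; just)
open import Data.Nat using (ℕ; zero; suc; _+_; _*_; _∸_; _≤_; _<_; _≤?_; _<?_; z≤n; s≤s; NonZero; >-nonZero; _%_; _/_)
open import Data.Nat.DivMod using (m%n<n; m≡m%n+[m/n]*n; m<n*o⇒m/o<n; [m+kn]%n≡m%n; m<n⇒m%n≡m)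
open import Data.Nat.Properties
open import Data.Nat.Solver using (module +-*-Solver)
open import Data.Product as Product using (Σ; ∃; ∃₂; _×_; _,_; proj₁; proj₂; uncurry)
open import Data.Product.Properties using () renaming (≡-dec to ≡-dec-×)
open import Data.Sum using (_⊎_; inj₁; inj₂; [_,_]; [_,_]′)
open import Data.Sum.Properties using () renaming (≡-dec to ≡-dec-⊎)
open import Data.Vec using (Vec; _∷_; []; lookup)
open import Function using (_∘_; const)
open import Algebra.Properties.Semiring.Sum +-*-semiring
  using (sum; sum-cong-≗; ∑-distrib-+; *-distribˡ-sum; sum-replicate-zero)
open import Relation.Binary.Definitions using (DecidableEquality)
open import Relation.Binary.PropositionalEquality
  using (_≡_; _≢_; refl; sym; trans; cong; cong₂; subst; subst₂; module ≡-Reasoning)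
open import Relation.Nullary using (Dec; yes; no; contradiction)
open import Relation.Nullary.Decidable using (from-yes; map′; _×-dec_; _⊎-dec_; _→-dec_)

open +-*-Solver using (solve; _:+_; _:*_; _:=_; con)

Σᶠ≡sum : ∀ {n} (f : Fin n → ℕ) → Σᶠ f ≡ sum f
Σᶠ≡sum {zero}  f = refl
Σᶠ≡sum {suc n} f = cong (f zero +_) (Σᶠ≡sum (f ∘ suc))

sum-↑ : ∀ m {k} (f : Fin (m + k) → ℕ) → sum f ≡ sum (f ∘ (_↑ˡ k)) + sum (f ∘ (m ↑ʳ_))
sum-↑ zero    f = refl
sum-↑ (suc m) f = trans (cong (f zero +_) (sum-↑ m (f ∘ suc))) (sym (+-assoc (f zero) _ _))

sum-zero : ∀ {n} {f : Fin n → ℕ} → (∀ i → f i ≡ 0) → sum f ≡ 0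
sum-zero {n} f≗0 = trans (sum-cong-≗ f≗0) (sum-replicate-zero n)

Cell : Set
Cell = ℕ × ℕ

Layout : ℕ → Set
Layout n = Fin n → Fin n → Maybe Cell

along : ∀ {n} {A : Set} → (Fin n → Fin n → A) → Line n → Fin n → A
along F (row i) j = F i j
along F (col j) i = F i j
along F leftD   i = F i i
along F rightD  i = F i (opposite i)

weigh : (Cell → ℕ) → Maybe Cell → ℕ
weigh f = maybe′ f 0

lineWeight : ∀ {n} → (Cell → ℕ) → Layout n → Line n → ℕ
lineWeight f L l = sum (weigh f ∘ along L l)

count labels offsets : ∀ {n} → Layout n → Line n → ℕ
count   = lineWeight (const 1)
labels  = lineWeight proj₁
offsets = lineWeight proj₂

module _ {n : ℕ} (L : Layout n) (l : Line n) where

  lineWeight-cong : ∀ {f g} → (∀ c → f c ≡ g c) → lineWeight f L l ≡ lineWeight g L l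
  lineWeight-cong {f} {g} f≗g = sum-cong-≗ (λ i → weigh-cong (along L l i))
    where
    weigh-cong : ∀ c → weigh f c ≡ weigh g c
    weigh-cong nothing  = refl
    weigh-cong (just c) = f≗g c

  lineWeight-+ : ∀ f g → lineWeight (λ c → f c + g c) L l ≡ lineWeight f L l + lineWeight g L l
  lineWeight-+ f g = trans (sum-cong-≗ (λ i → weigh-+ (along L l i))) (∑-distrib-+ (weigh f ∘ along L l) (weigh g ∘ along L l))
    where
    weigh-+ : ∀ c → weigh (λ c → f c + g c) c ≡ weigh f c + weigh g c
    weigh-+ nothing  = refl
    weigh-+ (just c) = refl

  lineWeight-* : ∀ m f → lineWeight (λ c → m * f c) L l ≡ m * lineWeight f L l
  lineWeight-* m f = trans (sum-cong-≗ (λ i → weigh-* (along L l i))) (sym (*-distribˡ-sum m (weigh f ∘ along L l)))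
    where
    weigh-* : ∀ c → weigh (λ c → m * f c) c ≡ m * weigh f c
    weigh-* nothing  = sym (*-zeroʳ m)
    weigh-* (just c) = refl

along-map : ∀ {n} {A B : Set} (g : A → B) (F : Fin n → Fin n → A) l i → along (λ i j → g (F i j)) l i ≡ g (along F l i)
along-map g F (row _) _ = refl
along-map g F (col _) _ = refl
along-map g F leftD   _ = refl
along-map g F rightD  _ = refl

lineWeight-map : ∀ {n} f (g : Cell → Cell) (L : Layout n) l →
  lineWeight f (λ i j → Maybe.map g (L i j)) l ≡ lineWeight (f ∘ g) L l
lineWeight-map f g L l =
  sum-cong-≗ λ i → trans (cong (weigh f) (along-map (Maybe.map g) L l i)) (maybe′-map f 0 g (along L l i))

-- From admissible layouts to regular SAMS(n,4)

entry : ℕ → Cell → ℕ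
entry n (k , w) = suc (k * n + w)

entry-digits : ∀ n c → entry n c ≡ n * proj₁ c + proj₂ c + 1
entry-digits n (k , w) = solve 3 (λ n k w → con 1 :+ (k :* n :+ w) := n :* k :+ w :+ con 1) refl n k w

toArray : ∀ {n} → Layout n → Array n
toArray {n} L i j = weigh (entry n) (L i j)

record Numbering {n} (L : Layout n) : Set where
  field
    inRange   : ∀ {i j k w} → L i j ≡ just (k , w) → k < 4 × w < n
    onto      : ∀ {k w} → k < 4 → w < n → ∃₂ λ i j → L i j ≡ just (k , w)
    injective : ∀ {i j i′ j′ c} → L i j ≡ just c → L i′ j′ ≡ just c → i ≡ i′ × j ≡ j′

record Admissible {n} (L : Layout n) : Set where
  field
    numbering         : Numbering L
    count≡4           : ∀ l → count L l ≡ 4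
    labels≡6          : ∀ l → labels L l ≡ 6
    offsets-lower     : ∀ l → n ≤ offsets L l + 2
    offsets-upper     : ∀ l → offsets L l < 3 * n
    offsets-injective : ∀ {l l′} → offsets L l ≡ offsets L l′ → l ≡ l′

digits-injective : ∀ {n k w k′ w′} → w < n → w′ < n → k * n + w ≡ k′ * n + w′ → k ≡ k′ × w ≡ w′
digits-injective {n} {k} {w} {k′} {w′} w<n w′<n eq = k≡k′ , w≡w′
  where
  instance _ = >-nonZero (≤-<-trans z≤n w<n)
  w≡w′ : w ≡ w′
  w≡w′ = begin
    w                ≡⟨ m<n⇒m%n≡m w<n ⟨
    w % n            ≡⟨ [m+kn]%n≡m%n w k n ⟨
    (w + k * n) % n  ≡⟨ cong (_% n) (trans (+-comm w (k * n)) (trans eq (+-comm (k′ * n) w′))) ⟩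
    (w′ + k′ * n) % n ≡⟨ [m+kn]%n≡m%n w′ k′ n ⟩
    w′ % n           ≡⟨ m<n⇒m%n≡m w′<n ⟩
    w′               ∎
    where open ≡-Reasoning
  k≡k′ : k ≡ k′
  k≡k′ = *-cancelʳ-≡ k k′ n (+-cancelʳ-≡ w (k * n) (k′ * n) (trans eq (cong (k′ * n +_) (sym w≡w′))))

entry-bound : ∀ {n k w} → k < 4 → w < n → entry n (k , w) ≤ n * 4
entry-bound {n} {k} {w} k<4 w<n = begin
  suc (k * n + w)  ≡⟨ +-suc (k * n) w ⟨
  k * n + suc w    ≤⟨ +-monoʳ-≤ (k * n) w<n ⟩
  k * n + n        ≡⟨ +-comm (k * n) n ⟩
  suc k * n        ≤⟨ *-monoˡ-≤ n k<4 ⟩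
  4 * n            ≡⟨ *-comm 4 n ⟩
  n * 4            ∎
  where open ≤-Reasoning

module _ {n : ℕ} {L : Layout n} where

  entries-toArray : ∀ l → entries (toArray L) l ≡ weigh (entry n) ∘ along L l
  entries-toArray (row i) = refl
  entries-toArray (col j) = refl
  entries-toArray leftD   = refl
  entries-toArray rightD  = refl

  lineSum-toArray : ∀ l → lineSum (toArray L) l ≡ n * labels L l + offsets L l + count L l
  lineSum-toArray l = begin
    lineSum (toArray L) l                                   ≡⟨ Σᶠ≡sum (entries (toArray L) l) ⟩
    sum (entries (toArray L) l)                             ≡⟨ cong sum (entries-toArray l) ⟩
    lineWeight (entry n) L l                                ≡⟨ lineWeight-cong L l (entry-digits n) ⟩
    lineWeight (λ c → n * proj₁ c + proj₂ c + 1) L l        ≡⟨ lineWeight-+ L l _ (const 1) ⟩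
    lineWeight (λ c → n * proj₁ c + proj₂ c) L l + count L l ≡⟨ cong (_+ count L l) (lineWeight-+ L l _ proj₂) ⟩
    lineWeight (λ c → n * proj₁ c) L l + offsets L l + count L l
      ≡⟨ cong (λ s → s + offsets L l + count L l) (lineWeight-* L l n proj₁) ⟩
    n * labels L l + offsets L l + count L l                ∎
    where open ≡-Reasoning

  positives-toArray : ∀ l → positives (entries (toArray L) l) ≡ count L l
  positives-toArray l = trans (cong positives (entries-toArray l)) (positives-weigh (along L l))
    where
    positives-weigh : ∀ {m} (c : Fin m → Maybe Cell) → positives (weigh (entry n) ∘ c) ≡ sum (weigh (const 1) ∘ c)
    positives-weigh {zero}  c = refl
    positives-weigh {suc m} c with c zero
    ... | nothing = positives-weigh (c ∘ suc)
    ... | just _  = cong suc (positives-weigh (c ∘ suc))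

  toArray-entriesOK : .{{NonZero n}} → Numbering L → EntriesOK n 4 (toArray L)
  toArray-entriesOK N = bounded , λ v 1≤v v≤4n → located v 1≤v v≤4n , unique 1≤v
    where
    open Numbering N

    bounded : ∀ i j → toArray L i j ≤ n * 4
    bounded i j with L i j in eq
    ... | nothing      = z≤n
    ... | just (k , w) = uncurry entry-bound (inRange eq)

    located : ∀ v → 1 ≤ v → v ≤ n * 4 → Σ (Fin n × Fin n) λ { (i , j) → toArray L i j ≡ v }
    located (suc u) _ v≤4n with onto (m<n*o⇒m/o<n (≤-trans v≤4n (≤-reflexive (*-comm n 4)))) (m%n<n u n)
    ... | i , j , eq = (i , j) , (begin
      toArray L i j          ≡⟨ cong (weigh (entry n)) eq ⟩
      suc (u / n * n + u % n) ≡⟨ cong suc (+-comm (u / n * n) (u % n)) ⟩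
      suc (u % n + u / n * n) ≡⟨ cong suc (m≡m%n+[m/n]*n u n) ⟨
      suc u                  ∎)
      where open ≡-Reasoning

    occupied : ∀ {i j v} → 1 ≤ v → toArray L i j ≡ v → ∃₂ λ k w → L i j ≡ just (k , w) × entry n (k , w) ≡ v
    occupied {i} {j} 1≤v e with L i j
    ... | just (k , w) = k , w , refl , e
    occupied {v = suc _} _ () | nothing

    unique : ∀ {v} → 1 ≤ v → ∀ i j i′ j′ → toArray L i j ≡ v → toArray L i′ j′ ≡ v → i ≡ i′ × j ≡ j′
    unique 1≤v i j i′ j′ e e′ with occupied 1≤v e | occupied 1≤v e′
    ... | k , w , eq , d | k′ , w′ , eq′ , d′
      with digits-injective {n} {k} {w} {k′} {w′} (proj₂ (inRange eq)) (proj₂ (inRange eq′)) (suc-injective (trans d (sym d′)))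
    ... | refl , refl = injective eq eq′

  lineSum-admissible : Admissible L → ∀ l → lineSum (toArray L) l ≡ 6 * n + 2 + (offsets L l + 2)
  lineSum-admissible A l = begin
    lineSum (toArray L) l                     ≡⟨ lineSum-toArray l ⟩
    n * labels L l + offsets L l + count L l  ≡⟨ cong₂ (λ k p → n * k + offsets L l + p) (labels≡6 l) (count≡4 l) ⟩
    n * 6 + offsets L l + 4
      ≡⟨ solve 2 (λ n w → n :* con 6 :+ w :+ con 4 := con 6 :* n :+ con 2 :+ (w :+ con 2)) refl n (offsets L l) ⟩
    6 * n + 2 + (offsets L l + 2)             ∎
    where
    open ≡-Reasoning
    open Admissible A

  toArray-consecutive : Admissible L → ConsecutiveSums n (toArray L)
  toArray-consecutive A = 6 * n + 2 + n , (λ l → lower l , upper l) , distinct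
    where
    open Admissible A
    lower : ∀ l → 6 * n + 2 + n ≤ lineSum (toArray L) l
    lower l = ≤-trans (+-monoʳ-≤ (6 * n + 2) (offsets-lower l)) (≤-reflexive (sym (lineSum-admissible A l)))
    upper : ∀ l → lineSum (toArray L) l < 6 * n + 2 + n + (2 * n + 2)
    upper l = begin-strict
      lineSum (toArray L) l          ≡⟨ lineSum-admissible A l ⟩
      6 * n + 2 + (offsets L l + 2)  <⟨ +-monoʳ-< (6 * n + 2) (+-monoˡ-< 2 (offsets-upper l)) ⟩
      6 * n + 2 + (3 * n + 2)
        ≡⟨ solve 1 (λ n → con 6 :* n :+ con 2 :+ (con 3 :* n :+ con 2) := con 6 :* n :+ con 2 :+ n :+ (con 2 :* n :+ con 2)) refl n ⟩
      6 * n + 2 + n + (2 * n + 2)    ∎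
      where open ≤-Reasoning
    distinct : ∀ l l′ → lineSum (toArray L) l ≡ lineSum (toArray L) l′ → l ≡ l′
    distinct l l′ e = offsets-injective (+-cancelʳ-≡ 2 _ _ (+-cancelˡ-≡ (6 * n + 2) _ _
      (trans (sym (lineSum-admissible A l)) (trans e (lineSum-admissible A l′)))))

  admissible⇒SAMS : 4 < n → Admissible L → SAMS n 4 (toArray L) × Regular n 4 (toArray L)
  admissible⇒SAMS 4<n A = (4<n , toArray-entriesOK N , toArray-consecutive A) , regular
    where
    open Admissible A renaming (numbering to N)
    instance _ = >-nonZero (≤-<-trans z≤n 4<n)
    regular : Regular n 4 (toArray L)
    regular l = trans (positives-toArray l) (count≡4 l)

lineCode : ∀ {n} → Line n → (Fin n ⊎ Fin n) ⊎ Bool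
lineCode (row i) = inj₁ (inj₁ i)
lineCode (col j) = inj₁ (inj₂ j)
lineCode leftD   = inj₂ true
lineCode rightD  = inj₂ false

lineDecode : ∀ {n} → (Fin n ⊎ Fin n) ⊎ Bool → Line n
lineDecode (inj₁ (inj₁ i)) = row i
lineDecode (inj₁ (inj₂ j)) = col j
lineDecode (inj₂ true)     = leftD
lineDecode (inj₂ false)    = rightD

lineDecode-lineCode : ∀ {n} (l : Line n) → lineDecode (lineCode l) ≡ l
lineDecode-lineCode (row i) = refl
lineDecode-lineCode (col j) = refl
lineDecode-lineCode leftD   = refl
lineDecode-lineCode rightD  = refl

_≟ᴸ_ : ∀ {n} → DecidableEquality (Line n)
l ≟ᴸ l′ = map′ code-injective (cong lineCode) (≡-dec-⊎ (≡-dec-⊎ _≟ᶠ_ _≟ᶠ_) _≟ᴮ_ (lineCode l) (lineCode l′))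
  where
  code-injective : lineCode l ≡ lineCode l′ → l ≡ l′
  code-injective e = trans (sym (lineDecode-lineCode l)) (trans (cong lineDecode e) (lineDecode-lineCode l′))

all-lines? : ∀ {n} {P : Line n → Set} → (∀ l → Dec (P l)) → Dec (∀ l → P l)
all-lines? {P = P} P? = map′ every (λ ∀P → ∀P ∘ row , ∀P ∘ col , ∀P leftD , ∀P rightD)
  (all? (P? ∘ row) ×-dec all? (P? ∘ col) ×-dec P? leftD ×-dec P? rightD)
  where
  every : (∀ i → P (row i)) × (∀ j → P (col j)) × P leftD × P rightD → ∀ l → P l
  every (r , c , d , a) (row i) = r i
  every (r , c , d , a) (col j) = c j
  every (r , c , d , a) leftD   = d
  every (r , c , d , a) rightD  = a

_≟ᶜ_ : DecidableEquality (Maybe Cell)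
_≟ᶜ_ = ≡-dec-Maybe (≡-dec-× _≟_ _≟_)

module _ {n : ℕ} (L : Layout n) where

  InRange : Cell → Set
  InRange (k , w) = k < 4 × w < n

  NumberingCheck : Set
  NumberingCheck =
    (∀ i j → All InRange (L i j)) ×
    (∀ (k : Fin 4) (w : Fin n) → ∃ λ i → ∃ λ j → L i j ≡ just (toℕ k , toℕ w)) ×
    (∀ i j i′ j′ → L i j ≡ L i′ j′ → L i j ≡ nothing ⊎ (i ≡ i′ × j ≡ j′))

  numberingCheck? : Dec NumberingCheck
  numberingCheck? =
    all? (λ i → all? λ j → All.dec (λ (k , w) → k <? 4 ×-dec w <? n) (L i j)) ×-dec
    all? (λ k → all? λ w → any? λ i → any? λ j → L i j ≟ᶜ just (toℕ k , toℕ w)) ×-dec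
    all? (λ i → all? λ j → all? λ i′ → all? λ j′ →
      (L i j ≟ᶜ L i′ j′) →-dec ((L i j ≟ᶜ nothing) ⊎-dec ((i ≟ᶠ i′) ×-dec (j ≟ᶠ j′))))

  numberingCheck-sound : NumberingCheck → Numbering L
  numberingCheck-sound (inRange , onto , injective) = record
    { inRange   = λ {i} {j} eq → unjust (subst (All InRange) eq (inRange i j))
    ; onto      = λ {k} {w} k<4 w<n → located (onto (fromℕ< k<4) (fromℕ< w<n)) (toℕ-fromℕ< k<4) (toℕ-fromℕ< w<n)
    ; injective = λ {i} {j} {i′} {j′} eq eq′ → occupied eq (injective i j i′ j′ (trans eq (sym eq′)))
    }
    where
    unjust : ∀ {c} → All InRange (just c) → InRange c
    unjust (just p) = p
    located : ∀ {k k′ w w′} → (∃ λ i → ∃ λ j → L i j ≡ just (k′ , w′)) → k′ ≡ k → w′ ≡ w →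
              ∃ λ i → ∃ λ j → L i j ≡ just (k , w)
    located cell refl refl = cell
    occupied : ∀ {i j i′ j′ c} → L i j ≡ just c → L i j ≡ nothing ⊎ (i ≡ i′ × j ≡ j′) → i ≡ i′ × j ≡ j′
    occupied eq (inj₁ eq′) with () ← trans (sym eq) eq′
    occupied eq (inj₂ same) = same

  LineCheck : Line n → Set
  LineCheck l = count L l ≡ 4 × labels L l ≡ 6 × n ≤ offsets L l + 2 × offsets L l < 3 * n

  AdmissibleCheck : Set
  AdmissibleCheck = NumberingCheck × (∀ l → LineCheck l) × (∀ l l′ → offsets L l ≡ offsets L l′ → l ≡ l′)

  admissibleCheck? : Dec AdmissibleCheck
  admissibleCheck? = numberingCheck? ×-dec
    all-lines? (λ l → count L l ≟ 4 ×-dec labels L l ≟ 6 ×-dec n ≤? offsets L l + 2 ×-dec offsets L l <? 3 * n) ×-dec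
    all-lines? (λ l → all-lines? λ l′ → (offsets L l ≟ offsets L l′) →-dec (l ≟ᴸ l′))

  admissibleCheck-sound : AdmissibleCheck → Admissible L
  admissibleCheck-sound (N , lines , distinct) = record
    { numbering         = numberingCheck-sound N
    ; count≡4           = proj₁ ∘ lines
    ; labels≡6          = proj₁ ∘ proj₂ ∘ lines
    ; offsets-lower     = proj₁ ∘ proj₂ ∘ proj₂ ∘ lines
    ; offsets-upper     = proj₂ ∘ proj₂ ∘ proj₂ ∘ lines
    ; offsets-injective = distinct _ _
    }

-- A nonzero table entry v is the cell of label (v ∸ 1) / n and offset (v ∸ 1) % n, so the tables
-- below are the arrays toArray (fromTable n t) themselves.
decode : (n : ℕ) .{{_ : NonZero n}} → ℕ → Maybe Cell
decode n zero    = nothing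
decode n (suc v) = just (v / n , v % n)

fromTable : (n : ℕ) .{{_ : NonZero n}} → Vec (Vec ℕ n) n → Layout n
fromTable n t i j = decode n (lookup (lookup t i) j)

-- Framing a core by a rim

opposite-↑ˡ : ∀ {a} b (g : Fin a) → opposite (g ↑ˡ (b + a)) ≡ a ↑ʳ (b ↑ʳ opposite g)
opposite-↑ˡ {a} b g = toℕ-injective (begin
  toℕ (opposite (g ↑ˡ (b + a)))        ≡⟨ opposite-prop (g ↑ˡ (b + a)) ⟩
  a + (b + a) ∸ suc (toℕ (g ↑ˡ (b + a))) ≡⟨ cong (λ t → a + (b + a) ∸ suc t) (toℕ-↑ˡ g (b + a)) ⟩
  a + (b + a) ∸ suc (toℕ g)             ≡⟨ cong (_∸ suc (toℕ g)) (+-assoc a b a) ⟨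
  a + b + a ∸ suc (toℕ g)               ≡⟨ +-∸-assoc (a + b) (toℕ<n g) ⟩
  a + b + (a ∸ suc (toℕ g))             ≡⟨ +-assoc a b _ ⟩
  a + (b + (a ∸ suc (toℕ g)))           ≡⟨ cong (λ t → a + (b + t)) (opposite-prop g) ⟨
  a + (b + toℕ (opposite g))            ≡⟨ cong (a +_) (toℕ-↑ʳ b (opposite g)) ⟨
  a + toℕ (b ↑ʳ opposite g)             ≡⟨ toℕ-↑ʳ a (b ↑ʳ opposite g) ⟨
  toℕ (a ↑ʳ (b ↑ʳ opposite g))         ∎)
  where open ≡-Reasoning

opposite-↑ʳ : ∀ {a} b (h : Fin a) → opposite (a ↑ʳ (b ↑ʳ h)) ≡ opposite h ↑ˡ (b + a)
opposite-↑ʳ {a} b h = begin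
  opposite (a ↑ʳ (b ↑ʳ h))                         ≡⟨ cong (λ t → opposite (a ↑ʳ (b ↑ʳ t))) (opposite-involutive h) ⟨
  opposite (a ↑ʳ (b ↑ʳ opposite (opposite h)))     ≡⟨ cong opposite (opposite-↑ˡ b (opposite h)) ⟨
  opposite (opposite (opposite h ↑ˡ (b + a)))      ≡⟨ opposite-involutive _ ⟩
  opposite h ↑ˡ (b + a)                            ∎
  where open ≡-Reasoning

opposite-↑ʳ↑ˡ : ∀ a {b} (i : Fin b) → opposite (a ↑ʳ (i ↑ˡ a)) ≡ a ↑ʳ (opposite i ↑ˡ a)
opposite-↑ʳ↑ˡ a {b} i = toℕ-injective (begin
  toℕ (opposite (a ↑ʳ (i ↑ˡ a)))          ≡⟨ opposite-prop (a ↑ʳ (i ↑ˡ a)) ⟩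
  a + (b + a) ∸ suc (toℕ (a ↑ʳ (i ↑ˡ a)))
    ≡⟨ cong (λ t → a + (b + a) ∸ suc t) (trans (toℕ-↑ʳ a (i ↑ˡ a)) (cong (a +_) (toℕ-↑ˡ i a))) ⟩
  a + (b + a) ∸ suc (a + toℕ i)            ≡⟨ cong (a + (b + a) ∸_) (+-suc a (toℕ i)) ⟨
  a + (b + a) ∸ (a + suc (toℕ i))          ≡⟨ [m+n]∸[m+o]≡n∸o a (b + a) (suc (toℕ i)) ⟩
  b + a ∸ suc (toℕ i)                      ≡⟨ +-∸-comm a (toℕ<n i) ⟩
  b ∸ suc (toℕ i) + a                      ≡⟨ +-comm _ a ⟩
  a + (b ∸ suc (toℕ i))                    ≡⟨ cong (a +_) (trans (toℕ-↑ˡ (opposite i) a) (opposite-prop i)) ⟨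
  a + toℕ (opposite i ↑ˡ a)                ≡⟨ toℕ-↑ʳ a (opposite i ↑ˡ a) ⟨
  toℕ (a ↑ʳ (opposite i ↑ˡ a))            ∎)
  where open ≡-Reasoning

data Part (a b : ℕ) : Set where
  rim  : Fin (a + a) → Part a b
  core : Fin b → Part a b

module _ {a b : ℕ} where

  top bot : Fin a → Fin (a + (b + a))
  top g = g ↑ˡ (b + a)
  bot h = a ↑ʳ (b ↑ʳ h)

  mid : Fin b → Fin (a + (b + a))
  mid i = a ↑ʳ (i ↑ˡ a)

  part : Fin (a + (b + a)) → Part a b
  part x = [ rim ∘ (_↑ˡ a) , [ core , rim ∘ (a ↑ʳ_) ]′ ∘ splitAt b ]′ (splitAt a x)

  unpart : Part a b → Fin (a + (b + a))
  unpart (rim G)  = [ top , bot ]′ (splitAt a G)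
  unpart (core i) = mid i

  part-top : ∀ g → part (top g) ≡ rim (g ↑ˡ a)
  part-top g rewrite splitAt-↑ˡ a g (b + a) = refl

  part-mid : ∀ i → part (mid i) ≡ core i
  part-mid i rewrite splitAt-↑ʳ a (b + a) (i ↑ˡ a) | splitAt-↑ˡ b i a = refl

  part-bot : ∀ h → part (bot h) ≡ rim (a ↑ʳ h)
  part-bot h rewrite splitAt-↑ʳ a (b + a) (b ↑ʳ h) | splitAt-↑ʳ b a h = refl

  data Position : Fin (a + (b + a)) → Set where
    at-top : ∀ g → Position (top g)
    at-mid : ∀ i → Position (mid i)
    at-bot : ∀ h → Position (bot h)

  position : ∀ x → Position x
  position x with splitAt a x | join-splitAt a (b + a) x
  ... | inj₁ g | refl = at-top g
  ... | inj₂ y | refl with splitAt b y | join-splitAt b a y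
  ...   | inj₁ i | refl = at-mid i
  ...   | inj₂ h | refl = at-bot h

  part-unpart : ∀ p → part (unpart p) ≡ p
  part-unpart (core i) = part-mid i
  part-unpart (rim G) with splitAt a G | join-splitAt a a G
  ... | inj₁ g | refl = part-top g
  ... | inj₂ h | refl = part-bot h

  unpart-part : ∀ x → unpart (part x) ≡ x
  unpart-part x with position x
  ... | at-top g rewrite part-top g | splitAt-↑ˡ a g a = refl
  ... | at-mid i rewrite part-mid i = refl
  ... | at-bot h rewrite part-bot h | splitAt-↑ʳ a a h = refl

  part-injective : ∀ {x y} → part x ≡ part y → x ≡ y
  part-injective {x} {y} e = trans (sym (unpart-part x)) (trans (cong unpart e) (unpart-part y))

  flip : Part a b → Part a b
  flip (rim G)  = rim (opposite G)
  flip (core i) = core (opposite i)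

  part-opposite : ∀ x → part (opposite x) ≡ flip (part x)
  part-opposite x with position x
  ... | at-top g rewrite opposite-↑ˡ b g | part-bot (opposite g) | part-top g = cong rim (sym (opposite-↑ˡ 0 g))
  ... | at-mid i rewrite opposite-↑ʳ↑ˡ a i | part-mid (opposite i) | part-mid i = refl
  ... | at-bot h rewrite opposite-↑ʳ b h | part-top (opposite h) | part-bot h = cong rim (sym (opposite-↑ʳ 0 h))

  sum-part : ∀ (f : Part a b → ℕ) → sum (f ∘ part) ≡ sum (f ∘ rim) + sum (f ∘ core)
  sum-part f = begin
    sum (f ∘ part)
      ≡⟨ sum-↑ a (f ∘ part) ⟩
    sum (f ∘ part ∘ top) + sum (f ∘ part ∘ (a ↑ʳ_))
      ≡⟨ cong (sum (f ∘ part ∘ top) +_) (sum-↑ b (f ∘ part ∘ (a ↑ʳ_))) ⟩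
    sum (f ∘ part ∘ top) + (sum (f ∘ part ∘ mid) + sum (f ∘ part ∘ bot))
      ≡⟨ cong₂ (λ s t → s + (t + sum (f ∘ part ∘ bot))) (sum-cong-≗ (cong f ∘ part-top)) (sum-cong-≗ (cong f ∘ part-mid)) ⟩
    T + (C + sum (f ∘ part ∘ bot))
      ≡⟨ cong (λ s → T + (C + s)) (sum-cong-≗ (cong f ∘ part-bot)) ⟩
    T + (C + B)
      ≡⟨ solve 3 (λ t c b → t :+ (c :+ b) := t :+ b :+ c) refl T C B ⟩
    T + B + C
      ≡⟨ cong (_+ C) (sum-↑ a (f ∘ rim)) ⟨
    sum (f ∘ rim) + C
      ∎
    where
    open ≡-Reasoning
    T = sum (f ∘ rim ∘ (_↑ˡ a))
    C = sum (f ∘ core)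
    B = sum (f ∘ rim ∘ (a ↑ʳ_))

RowOrCol : ℕ → Set
RowOrCol m = Fin m ⊎ Fin m

asLine : ∀ {m} → RowOrCol m → Line m
asLine = [ row , col ]′

data FrameLine (a b : ℕ) : Set where
  inner : Line b → FrameLine a b
  outer : RowOrCol (a + a) → FrameLine a b

record Framed {a b : ℕ} (B : Part a b → Part a b → Maybe Cell) : Set where
  field
    rim-core-empty         : ∀ G i → B (rim G) (core i) ≡ nothing
    core-rim-empty         : ∀ i G → B (core i) (rim G) ≡ nothing
    rim-diagonal-empty     : ∀ G → B (rim G) (rim G) ≡ nothing
    rim-antidiagonal-empty : ∀ G → B (rim G) (rim (opposite G)) ≡ nothing

module _ {a b : ℕ} where

  rowLine colLine : Part a b → FrameLine a b
  rowLine (rim G)  = outer (inj₁ G)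
  rowLine (core i) = inner (row i)
  colLine (rim H)  = outer (inj₂ H)
  colLine (core j) = inner (col j)

  classify : Line (a + (b + a)) → FrameLine a b
  classify (row x) = rowLine (part {a} {b} x)
  classify (col y) = colLine (part {a} {b} y)
  classify leftD   = inner leftD
  classify rightD  = inner rightD

  unclassify : FrameLine a b → Line (a + (b + a))
  unclassify (inner (row i))  = row (unpart {a} {b} (core i))
  unclassify (inner (col j))  = col (unpart {a} {b} (core j))
  unclassify (inner leftD)    = leftD
  unclassify (inner rightD)   = rightD
  unclassify (outer (inj₁ G)) = row (unpart {a} {b} (rim G))
  unclassify (outer (inj₂ H)) = col (unpart {a} {b} (rim H))

  unclassify-classify : ∀ l → unclassify (classify l) ≡ l
  unclassify-classify (row x) = trans (unclassify-rowLine (part x)) (cong row (unpart-part {a} {b} x))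
    where
    unclassify-rowLine : ∀ p → unclassify (rowLine p) ≡ row (unpart {a} {b} p)
    unclassify-rowLine (rim G)  = refl
    unclassify-rowLine (core i) = refl
  unclassify-classify (col y) = trans (unclassify-colLine (part y)) (cong col (unpart-part {a} {b} y))
    where
    unclassify-colLine : ∀ p → unclassify (colLine p) ≡ col (unpart {a} {b} p)
    unclassify-colLine (rim H)  = refl
    unclassify-colLine (core j) = refl
  unclassify-classify leftD  = refl
  unclassify-classify rightD = refl

  classify-injective : ∀ {l l′} → classify l ≡ classify l′ → l ≡ l′
  classify-injective {l} {l′} e =
    trans (sym (unclassify-classify l)) (trans (cong unclassify e) (unclassify-classify l′))

  module _ (B : Part a b → Part a b → Maybe Cell) where

    frameLayout : Layout (a + (b + a))
    frameLayout x y = B (part x) (part y)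

    innerLayout : Layout b
    innerLayout i j = B (core i) (core j)

    outerLayout : Layout (a + a)
    outerLayout G H = B (rim G) (rim H)

    frameWeight : (Cell → ℕ) → FrameLine a b → ℕ
    frameWeight f (inner l) = lineWeight f innerLayout l
    frameWeight f (outer r) = lineWeight f outerLayout (asLine r)

    lineWeight-frameLayout : Framed B → ∀ f l → lineWeight f frameLayout l ≡ frameWeight f (classify l)
    lineWeight-frameLayout F f (row x) = trans (sum-part (λ q → weigh f (B (part x) q))) (split (part x))
      where
      open Framed F
      split : ∀ p → sum (λ G → weigh f (B p (rim G))) + sum (λ i → weigh f (B p (core i))) ≡ frameWeight f (rowLine p)
      split (rim G)  =
        trans (cong (lineWeight f outerLayout (row G) +_) (sum-zero (cong (weigh f) ∘ rim-core-empty G))) (+-identityʳ _)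
      split (core i) = cong (_+ lineWeight f innerLayout (row i)) (sum-zero (cong (weigh f) ∘ core-rim-empty i))
    lineWeight-frameLayout F f (col y) = trans (sum-part (λ p → weigh f (B p (part y)))) (split (part y))
      where
      open Framed F
      split : ∀ q → sum (λ G → weigh f (B (rim G) q)) + sum (λ i → weigh f (B (core i) q)) ≡ frameWeight f (colLine q)
      split (rim H)  =
        trans (cong (lineWeight f outerLayout (col H) +_) (sum-zero (λ i → cong (weigh f) (core-rim-empty i H)))) (+-identityʳ _)
      split (core j) = cong (_+ lineWeight f innerLayout (col j)) (sum-zero (λ G → cong (weigh f) (rim-core-empty G j)))
    lineWeight-frameLayout F f leftD =
      trans (sum-part (λ p → weigh f (B p p)))
            (cong (_+ lineWeight f innerLayout leftD) (sum-zero (cong (weigh f) ∘ rim-diagonal-empty)))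
      where open Framed F
    lineWeight-frameLayout F f rightD = begin
      sum (λ x → weigh f (B (part x) (part (opposite x))))  ≡⟨ sum-cong-≗ (cong (weigh f ∘ B (part _)) ∘ part-opposite) ⟩
      sum (λ x → weigh f (B (part x) (flip (part x))))      ≡⟨ sum-part (λ p → weigh f (B p (flip p))) ⟩
      sum (λ G → weigh f (B (rim G) (rim (opposite G)))) + lineWeight f innerLayout rightD
        ≡⟨ cong (_+ lineWeight f innerLayout rightD) (sum-zero (cong (weigh f) ∘ rim-antidiagonal-empty)) ⟩
      lineWeight f innerLayout rightD                       ∎
      where
      open Framed F
      open ≡-Reasoning

-- The gadget

high : Cell → ℕ
high (k , x) with 6 + k ≤? x
... | yes _ = 1
... | no  _ = 0

highs : ∀ {n} → Layout n → Line n → ℕ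
highs = lineWeight high

opaque
  gadget : Layout 12
  gadget = fromTable 12
    ( ( 0 ∷  0 ∷ 26 ∷  0 ∷  0 ∷  4 ∷  0 ∷ 23 ∷ 37 ∷  0 ∷  0 ∷  0 ∷ []) ∷
      ( 0 ∷  0 ∷ 16 ∷  0 ∷  0 ∷  0 ∷ 41 ∷  0 ∷ 25 ∷  9 ∷  0 ∷  0 ∷ []) ∷
      (42 ∷  0 ∷  0 ∷  6 ∷  0 ∷  0 ∷  0 ∷ 31 ∷ 22 ∷  0 ∷  0 ∷  0 ∷ []) ∷
      ( 0 ∷  0 ∷  0 ∷  0 ∷  8 ∷  0 ∷ 27 ∷  0 ∷  0 ∷  0 ∷ 24 ∷ 48 ∷ []) ∷
      ( 0 ∷ 11 ∷  0 ∷  0 ∷  0 ∷  0 ∷ 21 ∷  0 ∷  0 ∷ 46 ∷  0 ∷ 30 ∷ []) ∷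
      ( 0 ∷  0 ∷  7 ∷ 43 ∷  0 ∷  0 ∷  0 ∷  0 ∷  0 ∷ 36 ∷  0 ∷ 20 ∷ []) ∷
      ( 0 ∷  0 ∷  0 ∷ 19 ∷ 29 ∷  0 ∷  0 ∷ 47 ∷  0 ∷  0 ∷  2 ∷  0 ∷ []) ∷
      (15 ∷ 28 ∷  0 ∷  0 ∷  0 ∷  0 ∷  0 ∷  0 ∷  0 ∷  0 ∷ 45 ∷ 12 ∷ []) ∷
      ( 1 ∷ 13 ∷ 39 ∷  0 ∷  0 ∷ 33 ∷  0 ∷  0 ∷  0 ∷  0 ∷  0 ∷  0 ∷ []) ∷
      ( 0 ∷ 40 ∷  0 ∷  0 ∷ 14 ∷  0 ∷  0 ∷ 10 ∷  0 ∷  0 ∷ 32 ∷  0 ∷ []) ∷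
      (35 ∷  0 ∷  0 ∷  0 ∷ 38 ∷ 17 ∷  5 ∷  0 ∷  0 ∷  0 ∷  0 ∷  0 ∷ []) ∷
      ( 0 ∷  0 ∷  0 ∷ 34 ∷  0 ∷ 44 ∷  0 ∷  0 ∷  3 ∷ 18 ∷  0 ∷  0 ∷ []) ∷ [])

Band : ℕ → ℕ → Set
Band h c = (h ≡ 1 × 10 ≤ c × c ≤ 27) ⊎ (h ≡ 3 × 30 ≤ c × c ≤ 35)

all-rowcol? : ∀ {m} {P : RowOrCol m → Set} → (∀ r → Dec (P r)) → Dec (∀ r → P r)
all-rowcol? P? =
  map′ (λ (p , q) → [ p , q ]) (λ ∀P → ∀P ∘ inj₁ , ∀P ∘ inj₂) (all? (P? ∘ inj₁) ×-dec all? (P? ∘ inj₂))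

GadgetCheck : Set
GadgetCheck =
  NumberingCheck gadget ×
  (∀ G → gadget G G ≡ nothing × gadget G (opposite G) ≡ nothing) ×
  (∀ r → count gadget (asLine r) ≡ 4 × labels gadget (asLine r) ≡ 6 ×
         Band (highs gadget (asLine r)) (offsets gadget (asLine r))) ×
  (∀ r r′ → offsets gadget (asLine r) ≡ offsets gadget (asLine r′) → r ≡ r′)

gadgetCheck? : Dec GadgetCheck
gadgetCheck? =
  numberingCheck? gadget ×-dec
  all? (λ G → gadget G G ≟ᶜ nothing ×-dec gadget G (opposite G) ≟ᶜ nothing) ×-dec
  all-rowcol? (λ r → count gadget (asLine r) ≟ 4 ×-dec labels gadget (asLine r) ≟ 6 ×-dec
                     band? (highs gadget (asLine r)) (offsets gadget (asLine r))) ×-dec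
  all-rowcol? (λ r → all-rowcol? λ r′ →
    (offsets gadget (asLine r) ≟ offsets gadget (asLine r′)) →-dec ≡-dec-⊎ _≟ᶠ_ _≟ᶠ_ r r′)
  where
  band? : ∀ h c → Dec (Band h c)
  band? h c = (h ≟ 1 ×-dec 10 ≤? c ×-dec c ≤? 27) ⊎-dec (h ≟ 3 ×-dec 30 ≤? c ×-dec c ≤? 35)

opaque
  unfolding gadget
  gadget-checked : GadgetCheck
  gadget-checked = from-yes gadgetCheck?

gadget-numbering : Numbering gadget
gadget-numbering = numberingCheck-sound gadget (proj₁ gadget-checked)

gadget-diagonal-empty : ∀ G → gadget G G ≡ nothing
gadget-diagonal-empty = proj₁ ∘ proj₁ (proj₂ gadget-checked)

gadget-antidiagonal-empty : ∀ G → gadget G (opposite G) ≡ nothing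
gadget-antidiagonal-empty = proj₂ ∘ proj₁ (proj₂ gadget-checked)

gadget-count : ∀ r → count gadget (asLine r) ≡ 4
gadget-count = proj₁ ∘ proj₁ (proj₂ (proj₂ gadget-checked))

gadget-labels : ∀ r → labels gadget (asLine r) ≡ 6
gadget-labels = proj₁ ∘ proj₂ ∘ proj₁ (proj₂ (proj₂ gadget-checked))

gadget-band : ∀ r → Band (highs gadget (asLine r)) (offsets gadget (asLine r))
gadget-band = proj₂ ∘ proj₂ ∘ proj₁ (proj₂ (proj₂ gadget-checked))

gadget-offsets-injective : ∀ {r r′} → offsets gadget (asLine r) ≡ offsets gadget (asLine r′) → r ≡ r′
gadget-offsets-injective = proj₂ (proj₂ (proj₂ gadget-checked)) _ _

shift : Cell → Cell
shift c = proj₁ c , 6 + proj₁ c + proj₂ c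

stretch : ℕ → Cell → Cell
stretch n c = proj₁ c , n * high c + proj₂ c

stretch-below : ∀ n {k x} → x < 6 + k → n * high (k , x) + x ≡ x
stretch-below n {k} {x} x<6+k with 6 + k ≤? x
... | yes 6+k≤x = contradiction 6+k≤x (<⇒≱ x<6+k)
... | no  _     = cong (_+ x) (*-zeroʳ n)

stretch-above : ∀ n {k x} → 6 + k ≤ x → n * high (k , x) + x ≡ n + x
stretch-above n {k} {x} 6+k≤x with 6 + k ≤? x
... | yes _     = cong (_+ x) (*-identityʳ n)
... | no  6+k≰x = contradiction 6+k≤x 6+k≰x

stretch-offset : ∀ n k x → (x < 6 + k × n * high (k , x) + x ≡ x) ⊎ (6 + k ≤ x × n * high (k , x) + x ≡ n + x)
stretch-offset n k x with x <? 6 + k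
... | yes x<6+k = inj₁ (x<6+k , stretch-below n x<6+k)
... | no  x≮6+k = inj₂ (≮⇒≥ x≮6+k , stretch-above n (≮⇒≥ x≮6+k))

shift-injective : ∀ {c c′} → shift c ≡ shift c′ → c ≡ c′
shift-injective {k , w} {k′ , w′} e with refl ← cong proj₁ e =
  cong (k ,_) (+-cancelˡ-≡ (6 + k) w w′ (cong proj₂ e))

below≢above : ∀ {n t y y′} → y < t → t ≤ y′ → y ≢ n + y′
below≢above {n} y<t t≤y′ = <⇒≢ (<-≤-trans y<t (≤-trans t≤y′ (m≤n+m _ n)))

stretch-injective : ∀ n {c c′} → stretch n c ≡ stretch n c′ → c ≡ c′
stretch-injective n {k , x} {k′ , x′} e with refl ← cong proj₁ e
  with stretch-offset n k x | stretch-offset n k x′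
... | inj₁ (_ , s) | inj₁ (_ , s′) = cong (k ,_) (trans (sym s) (trans (cong proj₂ e) s′))
... | inj₂ (_ , s) | inj₂ (_ , s′) = cong (k ,_) (+-cancelˡ-≡ n x x′ (trans (sym s) (trans (cong proj₂ e) s′)))
... | inj₁ (x<6+k , s) | inj₂ (6+k≤x′ , s′) =
  ⊥-elim (below≢above x<6+k 6+k≤x′ (trans (sym s) (trans (cong proj₂ e) s′)))
... | inj₂ (6+k≤x , s) | inj₁ (x′<6+k , s′) =
  ⊥-elim (below≢above x′<6+k 6+k≤x (sym (trans (sym s) (trans (cong proj₂ e) s′))))

shift≢stretch : ∀ n {c c′} → proj₂ c < n → shift c ≢ stretch n c′
shift≢stretch n {k , w} {k′ , x} w<n e with refl ← cong proj₁ e with stretch-offset n k x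
... | inj₁ (x<6+k , s) = <⇒≱ x<6+k (≤-trans (m≤m+n (6 + k) w) (≤-reflexive (trans (cong proj₂ e) s)))
... | inj₂ (6+k≤x , s) = <⇒≢ (begin-strict
  6 + k + w    <⟨ +-monoʳ-< (6 + k) w<n ⟩
  6 + k + n    ≡⟨ +-comm (6 + k) n ⟩
  n + (6 + k)  ≤⟨ +-monoʳ-≤ n 6+k≤x ⟩
  n + x        ∎) (trans (cong proj₂ e) s)
  where open ≤-Reasoning

frameCells : ∀ {n} → Layout n → Part 6 n → Part 6 n → Maybe Cell
frameCells L     (core i) (core j) = Maybe.map shift (L i j)
frameCells {n} L (rim G)  (rim H)  = Maybe.map (stretch n) (gadget G H)
frameCells L     (core _) (rim _)  = nothing
frameCells L     (rim _)  (core _) = nothing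

border : ∀ {n} → Layout n → Layout (6 + (n + 6))
border L = frameLayout (frameCells L)

module _ {n : ℕ} (L : Layout n) where

  data Source : Part 6 n → Part 6 n → Cell → Set where
    from-core : ∀ {i j c₀ c} → L i j ≡ just c₀ → shift c₀ ≡ c → Source (core i) (core j) c
    from-rim  : ∀ {G H c₀ c} → gadget G H ≡ just c₀ → stretch n c₀ ≡ c → Source (rim G) (rim H) c

  source : ∀ p q {c} → frameCells L p q ≡ just c → Source p q c
  source (core i) (core j) e with L i j in eq
  source (core i) (core j) e  | just _ = from-core eq (just-injective e)
  source (core i) (core j) () | nothing
  source (rim G)  (rim H)  e with gadget G H in eq
  source (rim G)  (rim H)  e  | just _ = from-rim eq (just-injective e)
  source (rim G)  (rim H)  () | nothing
  source (core i) (rim H)  ()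
  source (rim G)  (core j) ()

  module _ (N : Numbering L) where
    open Numbering

    source-inRange : ∀ {p q k v} → Source p q (k , v) → k < 4 × v < 6 + (n + 6)
    source-inRange (from-core {c₀ = k , w} eq refl) with inRange N eq
    ... | k<4 , w<n = k<4 , +-monoʳ-< 6 (begin-strict
      k + w  <⟨ +-mono-≤-< (≤-trans (<⇒≤ k<4) (m≤m+n 4 2)) w<n ⟩
      6 + n  ≡⟨ +-comm 6 n ⟩
      n + 6  ∎)
      where open ≤-Reasoning
    source-inRange (from-rim {G} {H} {k , x} eq refl) with inRange gadget-numbering {G} {H} eq | stretch-offset n k x
    ... | k<4 , x<12 | inj₁ (_ , s) = k<4 , (begin-strict
      n * high (k , x) + x  ≡⟨ s ⟩
      x                     <⟨ x<12 ⟩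
      12                    ≤⟨ +-monoʳ-≤ 6 (m≤n+m 6 n) ⟩
      6 + (n + 6)           ∎)
      where open ≤-Reasoning
    ... | k<4 , x<12 | inj₂ (_ , s) = k<4 , (begin-strict
      n * high (k , x) + x  ≡⟨ s ⟩
      n + x                 <⟨ +-monoʳ-< n x<12 ⟩
      n + 12                ≡⟨ solve 1 (λ n → n :+ con 12 := con 6 :+ (n :+ con 6)) refl n ⟩
      6 + (n + 6)           ∎)
      where open ≤-Reasoning

    gadget-cell : ∀ {k x v} → k < 4 → x < 12 → n * high (k , x) + x ≡ v → ∃₂ λ p q → frameCells L p q ≡ just (k , v)
    gadget-cell {k} k<4 x<12 e with onto gadget-numbering k<4 x<12
    ... | G , H , eq = rim G , rim H , trans (map-just eq) (cong (λ y → just (k , y)) e)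

    core-cell : ∀ {k w v} → k < 4 → w < n → 6 + k + w ≡ v → ∃₂ λ p q → frameCells L p q ≡ just (k , v)
    core-cell {k} k<4 w<n e with onto N k<4 w<n
    ... | i , j , eq = core i , core j , trans (map-just eq) (cong (λ y → just (k , y)) e)

    frameCells-onto : ∀ {k v} → k < 4 → v < 6 + (n + 6) → ∃₂ λ p q → frameCells L p q ≡ just (k , v)
    frameCells-onto {k} {v} k<4 v<N with v <? 6 + k
    ... | yes v<6+k = gadget-cell k<4 (<-≤-trans v<6+k (+-monoʳ-≤ 6 (≤-trans (<⇒≤ k<4) (m≤m+n 4 2)))) (stretch-below n v<6+k)
    ... | no  v≮6+k with v <? 6 + k + n
    ...   | yes v<6+k+n = core-cell k<4 (begin-strict
            v ∸ (6 + k)          <⟨ ∸-monoˡ-< v<6+k+n (≮⇒≥ v≮6+k) ⟩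
            6 + k + n ∸ (6 + k)  ≡⟨ m+n∸m≡n (6 + k) n ⟩
            n                    ∎)
          (m+[n∸m]≡n (≮⇒≥ v≮6+k))
      where open ≤-Reasoning
    ...   | no  v≮6+k+n = gadget-cell k<4 x<12 (trans (stretch-above n 6+k≤x) (m+[n∸m]≡n n≤v))
      where
      open ≤-Reasoning
      n≤v : n ≤ v
      n≤v = ≤-trans (m≤n+m n (6 + k)) (≮⇒≥ v≮6+k+n)
      6+k≤x : 6 + k ≤ v ∸ n
      6+k≤x = begin
        6 + k              ≡⟨ m+n∸n≡m (6 + k) n ⟨
        6 + k + n ∸ n      ≤⟨ ∸-monoˡ-≤ n (≮⇒≥ v≮6+k+n) ⟩
        v ∸ n              ∎
      x<12 : v ∸ n < 12
      x<12 = begin-strict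
        v ∸ n              <⟨ ∸-monoˡ-< v<N n≤v ⟩
        6 + (n + 6) ∸ n    ≡⟨ cong (_∸ n) (solve 1 (λ n → con 6 :+ (n :+ con 6) := n :+ con 12) refl n) ⟩
        n + 12 ∸ n         ≡⟨ m+n∸m≡n n 12 ⟩
        12                 ∎

    source-injective : ∀ {p q p′ q′ c} → Source p q c → Source p′ q′ c → p ≡ p′ × q ≡ q′
    source-injective (from-core eq e) (from-core eq′ e′) with refl ← shift-injective (trans e (sym e′)) =
      Product.map (cong core) (cong core) (injective N eq eq′)
    source-injective (from-rim eq e) (from-rim eq′ e′) with refl ← stretch-injective n (trans e (sym e′)) =
      Product.map (cong rim) (cong rim) (injective gadget-numbering eq eq′)
    source-injective (from-core eq e) (from-rim _ e′) =
      ⊥-elim (shift≢stretch n (proj₂ (inRange N eq)) (trans e (sym e′)))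
    source-injective (from-rim _ e) (from-core eq′ e′) =
      ⊥-elim (shift≢stretch n (proj₂ (inRange N eq′)) (trans e′ (sym e)))

    numbering-border : Numbering (border L)
    numbering-border = record
      { inRange   = λ {x} {y} eq → source-inRange (source (part x) (part y) eq)
      ; onto      = onto-border
      ; injective = λ {x} {y} {x′} {y′} eq eq′ →
          Product.map part-injective part-injective (source-injective (source (part x) (part y) eq) (source (part x′) (part y′) eq′))
      }
      where
      onto-border : ∀ {k v} → k < 4 → v < 6 + (n + 6) → ∃₂ λ x y → border L x y ≡ just (k , v)
      onto-border {k} {v} k<4 v<N with frameCells-onto k<4 v<N
      ... | p , q , eq = unpart p , unpart q ,
        subst₂ (λ p q → frameCells L p q ≡ just (k , v)) (sym (part-unpart p)) (sym (part-unpart q)) eq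

  framed : Framed (frameCells L)
  framed = record
    { rim-core-empty         = λ _ _ → refl
    ; core-rim-empty         = λ _ _ → refl
    ; rim-diagonal-empty     = map-nothing ∘ gadget-diagonal-empty
    ; rim-antidiagonal-empty = map-nothing ∘ gadget-antidiagonal-empty
    }

  borderWeight : (Cell → ℕ) → FrameLine 6 n → ℕ
  borderWeight f (inner l) = lineWeight (f ∘ shift) L l
  borderWeight f (outer r) = lineWeight (f ∘ stretch n) gadget (asLine r)

  lineWeight-border : ∀ f l → lineWeight f (border L) l ≡ borderWeight f (classify l)
  lineWeight-border f l = trans (lineWeight-frameLayout (frameCells L) framed f l) (frame≡border (classify l))
    where
    frame≡border : ∀ t → frameWeight (frameCells L) f t ≡ borderWeight f t
    frame≡border (inner l) = lineWeight-map f shift L l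
    frame≡border (outer r) = lineWeight-map f (stretch n) gadget (asLine r)

  module _ (A : Admissible L) where
    open Admissible A

    borderOffset : FrameLine 6 n → ℕ
    borderOffset (inner l) = 30 + offsets L l
    borderOffset (outer r) = n * highs gadget (asLine r) + offsets gadget (asLine r)

    offsets-border : ∀ l → offsets (border L) l ≡ borderOffset (classify l)
    offsets-border l = trans (lineWeight-border proj₂ l) (frame (classify l))
      where
      open ≡-Reasoning
      frame : ∀ t → borderWeight proj₂ t ≡ borderOffset t
      frame (inner l) = begin
        lineWeight (λ c → 6 + proj₁ c + proj₂ c) L l          ≡⟨ lineWeight-+ L l (λ c → 6 + proj₁ c) proj₂ ⟩
        lineWeight (λ c → 6 + proj₁ c) L l + offsets L l      ≡⟨ cong (_+ offsets L l) (lineWeight-+ L l (const 6) proj₁) ⟩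
        lineWeight (const 6) L l + labels L l + offsets L l
          ≡⟨ cong (λ s → s + labels L l + offsets L l) (lineWeight-* L l 6 (const 1)) ⟩
        6 * count L l + labels L l + offsets L l
          ≡⟨ cong₂ (λ p k → 6 * p + k + offsets L l) (count≡4 l) (labels≡6 l) ⟩
        30 + offsets L l                                      ∎
      frame (outer r) = begin
        lineWeight (λ c → n * high c + proj₂ c) gadget g         ≡⟨ lineWeight-+ gadget g (λ c → n * high c) proj₂ ⟩
        lineWeight (λ c → n * high c) gadget g + offsets gadget g ≡⟨ cong (_+ offsets gadget g) (lineWeight-* gadget g n high) ⟩
        n * highs gadget g + offsets gadget g                    ∎
        where g = asLine r

    inner-range : ∀ l → n + 28 ≤ borderOffset (inner l) × borderOffset (inner l) < 3 * n + 30
    inner-range l = lower , upper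
      where
      open ≤-Reasoning
      lower = begin
        n + 28               ≤⟨ +-monoˡ-≤ 28 (offsets-lower l) ⟩
        offsets L l + 2 + 28 ≡⟨ solve 1 (λ w → w :+ con 2 :+ con 28 := con 30 :+ w) refl (offsets L l) ⟩
        30 + offsets L l     ∎
      upper = begin-strict
        30 + offsets L l     <⟨ +-monoʳ-< 30 (offsets-upper l) ⟩
        30 + 3 * n           ≡⟨ +-comm 30 (3 * n) ⟩
        3 * n + 30           ∎

    outer-band : ∀ r → let o = borderOffset (outer r); h = highs gadget (asLine r) in
      (h ≡ 1 × n + 10 ≤ o × o ≤ n + 27) ⊎ (h ≡ 3 × 3 * n + 30 ≤ o × o ≤ 3 * n + 35)
    outer-band r with gadget-band r
    ... | inj₁ (h≡1 , lo , hi) rewrite h≡1 | *-identityʳ n = inj₁ (refl , +-monoʳ-≤ n lo , +-monoʳ-≤ n hi)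
    ... | inj₂ (h≡3 , lo , hi) rewrite h≡3 | *-comm n 3 = inj₂ (refl , +-monoʳ-≤ (3 * n) lo , +-monoʳ-≤ (3 * n) hi)

    n+27<3n+30 : n + 27 < 3 * n + 30
    n+27<3n+30 = +-mono-≤-< (m≤n*m n 3) (m≤m+n 28 2)

    borderOffset-lower : ∀ t → n + 10 ≤ borderOffset t
    borderOffset-lower (inner l) = ≤-trans (+-monoʳ-≤ n (m≤m+n 10 18)) (proj₁ (inner-range l))
    borderOffset-lower (outer r) with outer-band r
    ... | inj₁ (_ , lo , _) = lo
    ... | inj₂ (_ , lo , _) = ≤-trans (≤-trans (+-monoʳ-≤ n (m≤m+n 10 17)) (<⇒≤ n+27<3n+30)) lo

    borderOffset-upper : ∀ t → borderOffset t < 3 * n + 36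
    borderOffset-upper (inner l) = <-≤-trans (proj₂ (inner-range l)) (+-monoʳ-≤ (3 * n) (m≤m+n 30 6))
    borderOffset-upper (outer r) with outer-band r
    ... | inj₁ (_ , _ , hi) = ≤-<-trans hi (<-trans n+27<3n+30 (+-monoʳ-< (3 * n) (m≤m+n 31 5)))
    ... | inj₂ (_ , _ , hi) = ≤-<-trans hi (+-monoʳ-< (3 * n) (m≤m+n 36 0))

    inner≢outer : ∀ l r → borderOffset (inner l) ≢ borderOffset (outer r)
    inner≢outer l r e with outer-band r
    ... | inj₁ (_ , _ , hi) = <⇒≱ (≤-<-trans hi (+-monoʳ-< n ≤-refl)) (≤-trans (proj₁ (inner-range l)) (≤-reflexive e))
    ... | inj₂ (_ , lo , _) = <⇒≱ (proj₂ (inner-range l)) (≤-trans lo (≤-reflexive (sym e)))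

    cancel-heights : ∀ {r r′} → borderOffset (outer r) ≡ borderOffset (outer r′) →
      highs gadget (asLine r) ≡ highs gadget (asLine r′) → offsets gadget (asLine r) ≡ offsets gadget (asLine r′)
    cancel-heights {r} {r′} e h≡h′ =
      +-cancelˡ-≡ (n * highs gadget (asLine r)) _ _ (trans e (cong (λ h → n * h + offsets gadget (asLine r′)) (sym h≡h′)))

    outer-injective : ∀ {r r′} → borderOffset (outer r) ≡ borderOffset (outer r′) → r ≡ r′
    outer-injective {r} {r′} e with outer-band r | outer-band r′
    ... | inj₁ (h≡1 , _) | inj₁ (h′≡1 , _) = gadget-offsets-injective (cancel-heights {r} {r′} e (trans h≡1 (sym h′≡1)))
    ... | inj₂ (h≡3 , _) | inj₂ (h′≡3 , _) = gadget-offsets-injective (cancel-heights {r} {r′} e (trans h≡3 (sym h′≡3)))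
    ... | inj₁ (_ , _ , hi) | inj₂ (_ , lo′ , _) = ⊥-elim (<⇒≢ (≤-<-trans hi (<-≤-trans n+27<3n+30 lo′)) e)
    ... | inj₂ (_ , lo , _) | inj₁ (_ , _ , hi′) = ⊥-elim (<⇒≢ (≤-<-trans hi′ (<-≤-trans n+27<3n+30 lo)) (sym e))

    borderOffset-injective : ∀ {t t′} → borderOffset t ≡ borderOffset t′ → t ≡ t′
    borderOffset-injective {inner l} {inner l′} e = cong inner (offsets-injective (+-cancelˡ-≡ 30 _ _ e))
    borderOffset-injective {outer r} {outer r′} e = cong outer (outer-injective e)
    borderOffset-injective {inner l} {outer r} e = ⊥-elim (inner≢outer l r e)
    borderOffset-injective {outer r} {inner l} e = ⊥-elim (inner≢outer l r (sym e))

    admissible-border : Admissible (border L)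
    admissible-border = record
      { numbering         = numbering-border numbering
      ; count≡4           = λ l → trans (lineWeight-border (const 1) l) (count-frame (classify l))
      ; labels≡6          = λ l → trans (lineWeight-border proj₁ l) (labels-frame (classify l))
      ; offsets-lower     = λ l → subst (λ o → 6 + (n + 6) ≤ o + 2) (sym (offsets-border l)) (N≤ (classify l))
      ; offsets-upper     = λ l → subst (_< 3 * (6 + (n + 6))) (sym (offsets-border l)) (<3N (classify l))
      ; offsets-injective = λ {l} {l′} e →
          classify-injective (borderOffset-injective (trans (sym (offsets-border l)) (trans e (offsets-border l′))))
      }
      where
      count-frame : ∀ t → borderWeight (const 1) t ≡ 4
      count-frame (inner l) = count≡4 l
      count-frame (outer r) = gadget-count r
      labels-frame : ∀ t → borderWeight proj₁ t ≡ 6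
      labels-frame (inner l) = labels≡6 l
      labels-frame (outer r) = gadget-labels r
      N≤ : ∀ t → 6 + (n + 6) ≤ borderOffset t + 2
      N≤ t = ≤-trans (≤-reflexive (solve 1 (λ n → con 6 :+ (n :+ con 6) := n :+ con 10 :+ con 2) refl n))
                     (+-monoˡ-≤ 2 (borderOffset-lower t))
      <3N : ∀ t → borderOffset t < 3 * (6 + (n + 6))
      <3N t = <-≤-trans (borderOffset-upper t)
                        (≤-reflexive (solve 1 (λ n → con 3 :* n :+ con 36 := con 3 :* (con 6 :+ (n :+ con 6))) refl n))

-- Base cases and induction

opaque
  base7 : Layout 7
  base7 = fromTable 7
    ( ( 0 ∷ 11 ∷ 22 ∷  0 ∷  7 ∷ 18 ∷  0 ∷ []) ∷
      ( 3 ∷ 19 ∷  0 ∷  0 ∷ 12 ∷ 26 ∷  0 ∷ []) ∷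
      (13 ∷ 23 ∷  0 ∷  6 ∷ 20 ∷  0 ∷  0 ∷ []) ∷
      (21 ∷  0 ∷  0 ∷ 14 ∷ 27 ∷  0 ∷  2 ∷ []) ∷
      (24 ∷  0 ∷  5 ∷ 15 ∷  0 ∷  0 ∷  8 ∷ []) ∷
      ( 0 ∷  0 ∷  9 ∷ 28 ∷  0 ∷  1 ∷ 16 ∷ []) ∷
      ( 0 ∷  4 ∷ 17 ∷  0 ∷  0 ∷ 10 ∷ 25 ∷ []) ∷ [])

opaque
  unfolding base7
  admissible-base7 : Admissible base7
  admissible-base7 = admissibleCheck-sound base7 (from-yes (admissibleCheck? base7))

opaque
  base11 : Layout 11
  base11 = fromTable 11
    ( (38 ∷  0 ∷  0 ∷  0 ∷  7 ∷ 33 ∷  0 ∷  0 ∷  0 ∷  0 ∷ 22 ∷ []) ∷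
      ( 0 ∷  0 ∷  0 ∷  0 ∷ 12 ∷ 41 ∷  0 ∷  0 ∷  0 ∷  4 ∷ 23 ∷ []) ∷
      ( 0 ∷  0 ∷  0 ∷  1 ∷ 24 ∷  0 ∷  0 ∷  0 ∷  0 ∷ 13 ∷ 44 ∷ []) ∷
      ( 0 ∷  0 ∷  0 ∷ 14 ∷ 36 ∷  0 ∷  0 ∷  0 ∷  9 ∷ 25 ∷  0 ∷ []) ∷
      ( 0 ∷  0 ∷  6 ∷ 26 ∷  0 ∷  0 ∷  0 ∷  0 ∷ 15 ∷ 39 ∷  0 ∷ []) ∷
      ( 0 ∷  0 ∷ 16 ∷ 42 ∷  0 ∷  0 ∷  0 ∷  3 ∷ 27 ∷  0 ∷  0 ∷ []) ∷
      ( 0 ∷ 11 ∷ 28 ∷  0 ∷  0 ∷  0 ∷  0 ∷ 17 ∷ 34 ∷  0 ∷  0 ∷ []) ∷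
      ( 0 ∷ 18 ∷ 37 ∷  0 ∷  0 ∷  0 ∷  8 ∷ 29 ∷  0 ∷  0 ∷  0 ∷ []) ∷
      ( 5 ∷ 30 ∷  0 ∷  0 ∷  0 ∷  0 ∷ 19 ∷ 40 ∷  0 ∷  0 ∷  0 ∷ []) ∷
      (20 ∷ 43 ∷  0 ∷  0 ∷  0 ∷  2 ∷ 31 ∷  0 ∷  0 ∷  0 ∷  0 ∷ []) ∷
      (32 ∷  0 ∷  0 ∷  0 ∷  0 ∷ 21 ∷ 35 ∷  0 ∷  0 ∷  0 ∷ 10 ∷ []) ∷ [])

opaque
  unfolding base11
  admissible-base11 : Admissible base11
  admissible-base11 = admissibleCheck-sound base11 (from-yes (admissibleCheck? base11))

opaque
  base13 : Layout 13
  base13 = fromTable 13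
    ( ( 6 ∷ 29 ∷  0 ∷  0 ∷  0 ∷  0 ∷  0 ∷ 16 ∷ 47 ∷  0 ∷  0 ∷  0 ∷  0 ∷ []) ∷
      (17 ∷ 42 ∷  0 ∷  0 ∷  0 ∷  0 ∷ 11 ∷ 30 ∷  0 ∷  0 ∷  0 ∷  0 ∷  0 ∷ []) ∷
      (31 ∷  0 ∷  0 ∷  0 ∷  0 ∷  0 ∷ 18 ∷ 50 ∷  0 ∷  0 ∷  0 ∷  0 ∷  3 ∷ []) ∷
      (45 ∷  0 ∷  0 ∷  0 ∷  0 ∷  8 ∷ 32 ∷  0 ∷  0 ∷  0 ∷  0 ∷  0 ∷ 19 ∷ []) ∷
      ( 0 ∷  0 ∷  0 ∷  0 ∷  0 ∷ 20 ∷ 40 ∷  0 ∷  0 ∷  0 ∷  0 ∷ 13 ∷ 33 ∷ []) ∷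
      ( 0 ∷  0 ∷  0 ∷  0 ∷  5 ∷ 34 ∷  0 ∷  0 ∷  0 ∷  0 ∷  0 ∷ 21 ∷ 48 ∷ []) ∷
      ( 0 ∷  0 ∷  0 ∷  0 ∷ 22 ∷ 43 ∷  0 ∷  0 ∷  0 ∷  0 ∷ 10 ∷ 35 ∷  0 ∷ []) ∷
      ( 0 ∷  0 ∷  0 ∷  2 ∷ 36 ∷  0 ∷  0 ∷  0 ∷  0 ∷  0 ∷ 23 ∷ 51 ∷  0 ∷ []) ∷
      ( 0 ∷  0 ∷  0 ∷ 24 ∷ 46 ∷  0 ∷  0 ∷  0 ∷  0 ∷  7 ∷ 37 ∷  0 ∷  0 ∷ []) ∷
      ( 0 ∷  0 ∷ 12 ∷ 38 ∷  0 ∷  0 ∷  0 ∷  0 ∷  0 ∷ 25 ∷ 41 ∷  0 ∷  0 ∷ []) ∷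
      ( 0 ∷  0 ∷ 26 ∷ 49 ∷  0 ∷  0 ∷  0 ∷  0 ∷  4 ∷ 39 ∷  0 ∷  0 ∷  0 ∷ []) ∷
      ( 0 ∷  9 ∷ 27 ∷  0 ∷  0 ∷  0 ∷  0 ∷  0 ∷ 14 ∷ 44 ∷  0 ∷  0 ∷  0 ∷ []) ∷
      ( 0 ∷ 15 ∷ 52 ∷  0 ∷  0 ∷  0 ∷  0 ∷  1 ∷ 28 ∷  0 ∷  0 ∷  0 ∷  0 ∷ []) ∷ [])

opaque
  unfolding base13
  admissible-base13 : Admissible base13
  admissible-base13 = admissibleCheck-sound base13 (from-yes (admissibleCheck? base13))

opaque
  base17 : Layout 17
  base17 = fromTable 17
    ( ( 0 ∷  0 ∷  0 ∷  0 ∷  0 ∷ 12 ∷  0 ∷  0 ∷ 64 ∷  0 ∷  0 ∷  0 ∷  0 ∷  0 ∷ 29 ∷ 39 ∷  0 ∷ []) ∷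
      ( 0 ∷  0 ∷  0 ∷  0 ∷  0 ∷ 30 ∷ 51 ∷  0 ∷  0 ∷  0 ∷  0 ∷  0 ∷  0 ∷ 13 ∷  0 ∷  0 ∷ 52 ∷ []) ∷
      ( 0 ∷  0 ∷  0 ∷  0 ∷ 14 ∷  0 ∷  0 ∷ 57 ∷  0 ∷  0 ∷  0 ∷  0 ∷  0 ∷ 31 ∷ 46 ∷  0 ∷  0 ∷ []) ∷
      ( 0 ∷  0 ∷  0 ∷  0 ∷ 32 ∷ 41 ∷  0 ∷  0 ∷  0 ∷  0 ∷  0 ∷  0 ∷ 15 ∷  0 ∷  0 ∷ 62 ∷  0 ∷ []) ∷
      ( 0 ∷  0 ∷  0 ∷ 16 ∷  0 ∷  0 ∷ 67 ∷  0 ∷  0 ∷  0 ∷  0 ∷  0 ∷ 33 ∷ 36 ∷  0 ∷  0 ∷  0 ∷ []) ∷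
      ( 0 ∷  0 ∷  0 ∷ 34 ∷ 48 ∷  0 ∷  0 ∷  0 ∷  0 ∷  0 ∷  0 ∷ 17 ∷  0 ∷  0 ∷ 55 ∷  0 ∷  0 ∷ []) ∷
      ( 0 ∷  0 ∷  1 ∷  0 ∷  0 ∷ 60 ∷  0 ∷  0 ∷  0 ∷  0 ∷  0 ∷ 18 ∷ 43 ∷  0 ∷  0 ∷  0 ∷  0 ∷ []) ∷
      ( 0 ∷  0 ∷ 19 ∷ 38 ∷  0 ∷  0 ∷  0 ∷  0 ∷  0 ∷  0 ∷  2 ∷  0 ∷  0 ∷ 65 ∷  0 ∷  0 ∷  0 ∷ []) ∷
      ( 0 ∷  3 ∷  0 ∷  0 ∷ 53 ∷  0 ∷  0 ∷  0 ∷  0 ∷  0 ∷ 20 ∷ 50 ∷  0 ∷  0 ∷  0 ∷  0 ∷  0 ∷ []) ∷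
      ( 0 ∷ 21 ∷ 45 ∷  0 ∷  0 ∷  0 ∷  0 ∷  0 ∷  0 ∷  4 ∷  0 ∷  0 ∷ 58 ∷  0 ∷  0 ∷  0 ∷  0 ∷ []) ∷
      ( 5 ∷  0 ∷  0 ∷ 63 ∷  0 ∷  0 ∷  0 ∷  0 ∷  0 ∷ 22 ∷ 40 ∷  0 ∷  0 ∷  0 ∷  0 ∷  0 ∷  0 ∷ []) ∷
      (23 ∷ 35 ∷  0 ∷  0 ∷  0 ∷  0 ∷  0 ∷  0 ∷  6 ∷  0 ∷  0 ∷ 68 ∷  0 ∷  0 ∷  0 ∷  0 ∷  0 ∷ []) ∷
      ( 0 ∷  0 ∷ 56 ∷  0 ∷  0 ∷  0 ∷  0 ∷  0 ∷ 24 ∷ 47 ∷  0 ∷  0 ∷  0 ∷  0 ∷  0 ∷  0 ∷  7 ∷ []) ∷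
      (42 ∷  0 ∷  0 ∷  0 ∷  0 ∷  0 ∷  0 ∷  8 ∷  0 ∷  0 ∷ 61 ∷  0 ∷  0 ∷  0 ∷  0 ∷  0 ∷ 25 ∷ []) ∷
      ( 0 ∷ 66 ∷  0 ∷  0 ∷  0 ∷  0 ∷  0 ∷ 26 ∷ 37 ∷  0 ∷  0 ∷  0 ∷  0 ∷  0 ∷  0 ∷  9 ∷  0 ∷ []) ∷
      ( 0 ∷  0 ∷  0 ∷  0 ∷  0 ∷  0 ∷ 10 ∷  0 ∷  0 ∷ 54 ∷  0 ∷  0 ∷  0 ∷  0 ∷  0 ∷ 27 ∷ 49 ∷ []) ∷
      (59 ∷  0 ∷  0 ∷  0 ∷  0 ∷  0 ∷ 28 ∷ 44 ∷  0 ∷  0 ∷  0 ∷  0 ∷  0 ∷  0 ∷ 11 ∷  0 ∷  0 ∷ []) ∷ [])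

opaque
  unfolding base17
  admissible-base17 : Admissible base17
  admissible-base17 = admissibleCheck-sound base17 (from-yes (admissibleCheck? base17))

AdmissibleLayout : ℕ → Set
AdmissibleLayout n = Σ (Layout n) Admissible

iterate-border : ∀ {b} → AdmissibleLayout b → ∀ q → AdmissibleLayout (b + q * 12)
iterate-border {b} X zero = subst AdmissibleLayout (sym (+-identityʳ b)) X
iterate-border {b} X (suc q) with iterate-border X q
... | L , A = subst AdmissibleLayout
  (solve 2 (λ b q → con 6 :+ (b :+ q :* con 12 :+ con 6) := b :+ (con 1 :+ q) :* con 12) refl b q)
  (border L , admissible-border L A)

residue-mod6 : ∀ r q → (r + q * 12) % 6 ≡ r % 6
residue-mod6 r q = trans (cong (λ t → (r + t) % 6) (sym (*-assoc q 2 6))) ([m+kn]%n≡m%n r (q * 2) 6)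

admissibleLayout-mod12 : ∀ r q → r < 12 → 7 ≤ r + q * 12 → r % 6 ≡ 1 ⊎ r % 6 ≡ 5 → AdmissibleLayout (r + q * 12)
admissibleLayout-mod12 1  (suc q) _ _ _ = iterate-border (base13 , admissible-base13) q
admissibleLayout-mod12 5  (suc q) _ _ _ = iterate-border (base17 , admissible-base17) q
admissibleLayout-mod12 7  q       _ _ _ = iterate-border (base7  , admissible-base7)  q
admissibleLayout-mod12 11 q       _ _ _ = iterate-border (base11 , admissible-base11) q
admissibleLayout-mod12 1  zero    _ (s≤s ()) _
admissibleLayout-mod12 5  zero    _ (s≤s (s≤s (s≤s (s≤s (s≤s ()))))) _
admissibleLayout-mod12 0  _ _ _ (inj₁ ())
admissibleLayout-mod12 0  _ _ _ (inj₂ ())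
admissibleLayout-mod12 2  _ _ _ (inj₁ ())
admissibleLayout-mod12 2  _ _ _ (inj₂ ())
admissibleLayout-mod12 3  _ _ _ (inj₁ ())
admissibleLayout-mod12 3  _ _ _ (inj₂ ())
admissibleLayout-mod12 4  _ _ _ (inj₁ ())
admissibleLayout-mod12 4  _ _ _ (inj₂ ())
admissibleLayout-mod12 6  _ _ _ (inj₁ ())
admissibleLayout-mod12 6  _ _ _ (inj₂ ())
admissibleLayout-mod12 8  _ _ _ (inj₁ ())
admissibleLayout-mod12 8  _ _ _ (inj₂ ())
admissibleLayout-mod12 9  _ _ _ (inj₁ ())
admissibleLayout-mod12 9  _ _ _ (inj₂ ())
admissibleLayout-mod12 10 _ _ _ (inj₁ ())
admissibleLayout-mod12 10 _ _ _ (inj₂ ())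
admissibleLayout-mod12 (suc (suc (suc (suc (suc (suc (suc (suc (suc (suc (suc (suc _))))))))))))
  _ (s≤s (s≤s (s≤s (s≤s (s≤s (s≤s (s≤s (s≤s (s≤s (s≤s (s≤s (s≤s ())))))))))))) _ _

admissibleLayout-exists : ∀ n → 7 ≤ n → n % 6 ≡ 1 ⊎ n % 6 ≡ 5 → AdmissibleLayout n
admissibleLayout-exists n 7≤n n%6 = subst AdmissibleLayout (sym n≡r+q*12)
  (admissibleLayout-mod12 r q (m%n<n n 12) (subst (7 ≤_) n≡r+q*12 7≤n) (subst (λ m → m ≡ 1 ⊎ m ≡ 5) n%6≡r%6 n%6))
  where
  r q : ℕ
  r = n % 12
  q = n / 12
  n≡r+q*12 : n ≡ r + q * 12
  n≡r+q*12 = m≡m%n+[m/n]*n n 12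
  n%6≡r%6 : n % 6 ≡ r % 6
  n%6≡r%6 = trans (cong (_% 6) n≡r+q*12) (residue-mod6 r q)

theorem5p1 : (n : ℕ) → 7 ≤ n → (n % 6 ≡ 1 ⊎ n % 6 ≡ 5) →
    Σ (Array n) λ A → SAMS n 4 A × Regular n 4 A
theorem5p1 n 7≤n n%6 with admissibleLayout-exists n 7≤n n%6
... | L , A = toArray L , admissible⇒SAMS (≤-trans (m≤m+n 5 2) 7≤n) A
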